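{- Suppose we have an instance of eBVP of the form $M + x_1 + 2 x_2 + \ldots + 2^{n - 1} x_n$. Consider any prime number $p < 2^n$ and the binary representation $b_1, \ldots, b_k$ of any number $0 \le t < 2^n$ such that $t \equiv -M\ (\text{mod } p)$. Suppose we introduced extension variable $y_i$ for which we have a derivation in Extended Polynomial Calculus over $\mathbb{Z}$ with the square root rule of the polynomial equation $C' \cdot (y_i^2 - y_i) = 0$ from $M + x_1 + 2 x_2 + \ldots + 2^{n - 1} x_n$. Then, either the number $C'$ is divisible by $p$, or $y_i|_{x_1 = b_1, \ldots, x_n = b_n} \equiv 1\ (\text{mod } p)$, or $y_i|_{x_1 = b_1, \ldots, x_n = b_n} \equiv 0\ (\text{mod } p)$.
   Context: $M>0$ is an integer; derivations also use the Boolean axioms $x_i^2-x_i=0$. Extended Polynomial Calculus over $\mathbb{Z}$ derives polynomials (read as equations $=0$) by integer linear combinations and multiplication by variables, allows extension axioms $y_j - q_j(\bar x, y_1,\ldots,y_{j-1})$ introducing new variables, and the square root rule derives $r$ from $r^2$. For extension variables introduced as $y_i = q_i(\bar x, y_1,\ldots,y_{i-1})$ and bits $b_1,\ldots,b_n$, the value $y_i|_{x_1=b_1,\ldots,x_n=b_n}$ is defined recursively by $y_i|_{x=b} := q_i(b_1,\ldots,b_n, y_1|_{x=b},\ldots,y_{i-1}|_{x=b})$. -}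

module Defs where

open import Data.Nat as ℕ using (ℕ; zero; suc; _^_)
open import Data.Integer as ℤ using (ℤ; +_; _-_)
open import Data.Fin using (Fin; zero; suc; toℕ; fromℕ; inject₁)
open import Data.Sum using (_⊎_; inj₁; inj₂; [_,_])
import Data.Sum as Sum
open import Data.Maybe using (Maybe; just; nothing)
import Data.Maybe as Maybe
open import Data.Bool using (Bool; true; false)
open import Relation.Binary.PropositionalEquality using (_≡_)

data Poly (V : Set) : Set where
  var  : V → Poly V
  con  : ℤ → Poly V
  _⊕_  : Poly V → Poly V → Poly V
  _⊗_  : Poly V → Poly V → Poly V

infixl 6 _⊕_ _⊖_
infixl 7 _⊗_

_⊖_ : ∀ {V} → Poly V → Poly V → Poly V
p ⊖ q = p ⊕ (con (ℤ.- (+ 1)) ⊗ q)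

⟦_⟧ : ∀ {V} → Poly V → (V → ℤ) → ℤ
⟦ var v ⟧ ρ = ρ v
⟦ con c ⟧ ρ = c
⟦ p ⊕ q ⟧ ρ = ⟦ p ⟧ ρ ℤ.+ ⟦ q ⟧ ρ
⟦ p ⊗ q ⟧ ρ = ⟦ p ⟧ ρ ℤ.* ⟦ q ⟧ ρ

-- equality of polynomials in ℤ[V]: since ℤ is an infinite integral
-- domain, two polynomials are equal iff they agree on every integer point.
_≈_ : ∀ {V} → Poly V → Poly V → Set
p ≈ q = ∀ ρ → ⟦ p ⟧ ρ ≡ ⟦ q ⟧ ρ

rename : ∀ {V W} → (V → W) → Poly V → Poly W
rename f (var v) = var (f v)
rename f (con c) = con c
rename f (p ⊕ q) = rename f p ⊕ rename f q
rename f (p ⊗ q) = rename f p ⊗ rename f q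

-- Extensions: y_j = q_j(x_1..x_n, y_0..y_{j-1}), j = 0..m-1.
-- Variables of ℤ[x, y_0..y_{m-1}] are  Fin n ⊎ Fin m  (inj₁ i = x_{i+1}).

data Ext (n : ℕ) : ℕ → Set where
  []  : Ext n 0
  _▷_ : ∀ {m} → Ext n m → Poly (Fin n ⊎ Fin m) → Ext n (suc m)

-- nothing  = the last index m ; just k = the earlier index k
unsnoc : ∀ m → Fin (suc m) → Maybe (Fin m)
unsnoc zero    zero    = nothing
unsnoc (suc m) zero    = just zero
unsnoc (suc m) (suc i) = Maybe.map suc (unsnoc m i)

extAx : ∀ {n m} → Ext n m → Fin m → Poly (Fin n ⊎ Fin m)
extAx {m = suc m} (E ▷ q) j with unsnoc m j
... | nothing = var (inj₂ (fromℕ m)) ⊖ rename (Sum.map₂ inject₁) q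
... | just k  = rename (Sum.map₂ inject₁) (extAx E k)

val : ∀ {n m} → Ext n m → (Fin n → ℤ) → Fin m → ℤ
val {m = suc m} (E ▷ q) b j with unsnoc m j
... | nothing = ⟦ q ⟧ [ b , val E b ]
... | just k  = val E b k

sumFin : ∀ {A : Set} (n : ℕ) → (A → A → A) → A → (Fin n → A) → A
sumFin zero    _+_ z f = z
sumFin (suc n) _+_ z f = f zero + sumFin n _+_ z (λ i → f (suc i))

ebvp : ∀ {m} (M n : ℕ) → Poly (Fin n ⊎ Fin m)
ebvp M n = con (+ M) ⊕
  sumFin n _⊕_ (con (+ 0)) (λ i → con (+ (2 ^ toℕ i)) ⊗ var (inj₁ i))

data Derivable {n m : ℕ} (E : Ext n m) (P : Poly (Fin n ⊎ Fin m))
       : Poly (Fin n ⊎ Fin m) → Set where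
  axiom   : Derivable E P P
  boolean : (i : Fin n) →
            Derivable E P (var (inj₁ i) ⊗ var (inj₁ i) ⊖ var (inj₁ i))
  extax   : (j : Fin m) → Derivable E P (extAx E j)
  lincomb : ∀ {p q} (a c : ℤ) → Derivable E P p → Derivable E P q →
            Derivable E P (con a ⊗ p ⊕ con c ⊗ q)
  mulvar  : ∀ {p} (v : Fin n ⊎ Fin m) → Derivable E P p →
            Derivable E P (var v ⊗ p)
  sqrt    : ∀ {s} (r : Poly (Fin n ⊎ Fin m)) → Derivable E P s →
            s ≈ (r ⊗ r) → Derivable E P r
  -- lines are polynomials, i.e. taken up to polynomial identity
  conv    : ∀ {p q} → Derivable E P p → p ≈ q → Derivable E P q

bit : Bool → ℕ
bit false = 0
bit true  = 1

bitℤ : Bool → ℤ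
bitℤ b = + bit b

binVal : (n : ℕ) → (Fin n → Bool) → ℕ
binVal n b = sumFin n ℕ._+_ 0 (λ i → 2 ^ toℕ i ℕ.* bit (b i))

-- Evaluate every line of the derivation at the point whose x-part is the bit
-- vector b of t and whose y-part is given by the extension definitions.  At that
-- point the extension and Boolean axioms vanish and the eBVP axiom equals
-- t + M ≡ 0 (mod p), and every rule preserves "p divides the value": linear
-- combinations and multiplication by a variable trivially, the square-root rule
-- because p is prime.  Hence p ∣ C′ · y (y − 1) at that point, and Euclid's lemma
-- splits this into the three cases.
module Submission where

open import Defs
open import Data.Nat using (ℕ; _<_; _^_; _+_)
open import Data.Nat.Primality using (Prime; euclidsLemma)
open import Data.Integer using (ℤ; +_; _-_)
open import Data.Fin using (Fin)
open import Data.Sum using (_⊎_; inj₂)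
open import Data.Bool using (Bool)
open import Relation.Binary.PropositionalEquality using (_≡_)
import Data.Nat.Divisibility as ℕD
import Data.Integer.Divisibility as ℤD

import Data.Nat as ℕ
import Data.Nat.Properties as ℕ
import Data.Integer as ℤ
import Data.Integer.Properties as ℤ
open import Data.Integer.Divisibility.Signed as Signed using (∣ᵤ⇒∣; ∣⇒∣ᵤ)
open import Data.Integer.Tactic.RingSolver using (solve-∀)
open import Data.Fin using (zero; suc; toℕ; fromℕ; inject₁)
open import Data.Sum using (inj₁; [_,_]; [_,_]′; map₂; swap)
open import Data.Maybe using (just; nothing)
open import Data.Bool using (true; false)
open import Function using (_∘_; id)
open import Relation.Binary.PropositionalEquality
  using (refl; cong; cong₂; sym; trans; subst; module ≡-Reasoning)

⟦⟧-cong : ∀ {V} (q : Poly V) {ρ σ : V → ℤ} → (∀ v → ρ v ≡ σ v) → ⟦ q ⟧ ρ ≡ ⟦ q ⟧ σ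
⟦⟧-cong (var v) ρ≗σ = ρ≗σ v
⟦⟧-cong (con c) ρ≗σ = refl
⟦⟧-cong (p ⊕ q) ρ≗σ = cong₂ ℤ._+_ (⟦⟧-cong p ρ≗σ) (⟦⟧-cong q ρ≗σ)
⟦⟧-cong (p ⊗ q) ρ≗σ = cong₂ ℤ._*_ (⟦⟧-cong p ρ≗σ) (⟦⟧-cong q ρ≗σ)

⟦rename⟧ : ∀ {V W} (f : V → W) (q : Poly V) (ρ : W → ℤ) →
           ⟦ rename f q ⟧ ρ ≡ ⟦ q ⟧ (ρ ∘ f)
⟦rename⟧ f (var v) ρ = refl
⟦rename⟧ f (con c) ρ = refl
⟦rename⟧ f (p ⊕ q) ρ = cong₂ ℤ._+_ (⟦rename⟧ f p ρ) (⟦rename⟧ f q ρ)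
⟦rename⟧ f (p ⊗ q) ρ = cong₂ ℤ._*_ (⟦rename⟧ f p ρ) (⟦rename⟧ f q ρ)

⟦sumFin⟧ : ∀ {V} n (f : Fin n → Poly V) (g : Fin n → ℕ) (ρ : V → ℤ) →
           (∀ i → ⟦ f i ⟧ ρ ≡ + g i) →
           ⟦ sumFin n _⊕_ (con (+ 0)) f ⟧ ρ ≡ + sumFin n ℕ._+_ 0 g
⟦sumFin⟧ ℕ.zero    f g ρ f≗g = refl
⟦sumFin⟧ (ℕ.suc n) f g ρ f≗g = begin
  ⟦ f zero ⟧ ρ ℤ.+ ⟦ sumFin n _⊕_ (con (+ 0)) (f ∘ suc) ⟧ ρ
    ≡⟨ cong₂ ℤ._+_ (f≗g zero) (⟦sumFin⟧ n (f ∘ suc) (g ∘ suc) ρ (f≗g ∘ suc)) ⟩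
  + g zero ℤ.+ + sumFin n ℕ._+_ 0 (g ∘ suc)
    ≡⟨ ℤ.pos-+ (g zero) _ ⟨
  + sumFin (ℕ.suc n) ℕ._+_ 0 g ∎
  where open ≡-Reasoning

unsnoc-fromℕ : ∀ m → unsnoc m (fromℕ m) ≡ nothing
unsnoc-fromℕ ℕ.zero    = refl
unsnoc-fromℕ (ℕ.suc m) rewrite unsnoc-fromℕ m = refl

unsnoc-inject₁ : ∀ m (k : Fin m) → unsnoc m (inject₁ k) ≡ just k
unsnoc-inject₁ (ℕ.suc m) zero    = refl
unsnoc-inject₁ (ℕ.suc m) (suc k) rewrite unsnoc-inject₁ m k = refl

extEnv : ∀ {n m} → Ext n m → (Fin n → ℤ) → Fin n ⊎ Fin m → ℤ
extEnv E b = [ b , val E b ]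

val-fromℕ : ∀ {n m} (E : Ext n m) q b → val (E ▷ q) b (fromℕ m) ≡ ⟦ q ⟧ (extEnv E b)
val-fromℕ {m = m} E q b with unsnoc m (fromℕ m) | unsnoc-fromℕ m
... | .nothing | refl = refl

val-inject₁ : ∀ {n m} (E : Ext n m) q b k → val (E ▷ q) b (inject₁ k) ≡ val E b k
val-inject₁ {m = m} E q b k with unsnoc m (inject₁ k) | unsnoc-inject₁ m k
... | .(just k) | refl = refl

extEnv-inject₁ : ∀ {n m} (E : Ext n m) q b (v : Fin n ⊎ Fin m) →
                 extEnv (E ▷ q) b (map₂ inject₁ v) ≡ extEnv E b v
extEnv-inject₁ E q b (inj₁ x) = refl
extEnv-inject₁ E q b (inj₂ k) = val-inject₁ E q b k

⟦rename-inject₁⟧ : ∀ {n m} (E : Ext n m) q b (r : Poly (Fin n ⊎ Fin m)) →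
                   ⟦ rename (map₂ inject₁) r ⟧ (extEnv (E ▷ q) b) ≡ ⟦ r ⟧ (extEnv E b)
⟦rename-inject₁⟧ E q b r =
  trans (⟦rename⟧ (map₂ inject₁) r _) (⟦⟧-cong r (extEnv-inject₁ E q b))

x-x≡0 : ∀ x → x ℤ.+ ℤ.-1ℤ ℤ.* x ≡ ℤ.0ℤ
x-x≡0 = solve-∀

⟦extAx⟧≡0 : ∀ {n m} (E : Ext n m) b (j : Fin m) → ⟦ extAx E j ⟧ (extEnv E b) ≡ ℤ.0ℤ
⟦extAx⟧≡0 {m = ℕ.suc m} (E ▷ q) b j with unsnoc m j
... | nothing = begin
  val (E ▷ q) b (fromℕ m) ℤ.+ ℤ.-1ℤ ℤ.* ⟦ rename (map₂ inject₁) q ⟧ (extEnv (E ▷ q) b)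
    ≡⟨ cong₂ (λ y z → y ℤ.+ ℤ.-1ℤ ℤ.* z) (val-fromℕ E q b) (⟦rename-inject₁⟧ E q b q) ⟩
  ⟦ q ⟧ (extEnv E b) ℤ.+ ℤ.-1ℤ ℤ.* ⟦ q ⟧ (extEnv E b)
    ≡⟨ x-x≡0 (⟦ q ⟧ (extEnv E b)) ⟩
  ℤ.0ℤ ∎
  where open ≡-Reasoning
... | just k = trans (⟦rename-inject₁⟧ E q b (extAx E k)) (⟦extAx⟧≡0 E b k)

⟦ebvp⟧ : ∀ {m} M n (E : Ext n m) (b : Fin n → Bool) →
         ⟦ ebvp M n ⟧ (extEnv E (bitℤ ∘ b)) ≡ + (M + binVal n b)
⟦ebvp⟧ M n E b = begin
  + M ℤ.+ ⟦ sumFin n _⊕_ (con (+ 0)) (λ i → con (+ (2 ^ toℕ i)) ⊗ var (inj₁ i)) ⟧ _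
    ≡⟨ cong (ℤ._+_ (+ M)) (⟦sumFin⟧ n _ _ _ (λ i → sym (ℤ.pos-* (2 ^ toℕ i) (bit (b i))))) ⟩
  + M ℤ.+ + binVal n b
    ≡⟨ ℤ.pos-+ M (binVal n b) ⟨
  + (M + binVal n b) ∎
  where open ≡-Reasoning

bitℤ-idempotent : ∀ x → bitℤ x ℤ.* bitℤ x ℤ.+ ℤ.-1ℤ ℤ.* bitℤ x ≡ ℤ.0ℤ
bitℤ-idempotent false = refl
bitℤ-idempotent true  = refl

prime∣*⇒∣⊎∣ : ∀ {p} → Prime p → ∀ i j → + p ℤD.∣ i ℤ.* j → + p ℤD.∣ i ⊎ + p ℤD.∣ j
prime∣*⇒∣⊎∣ {p} p-prime i j =
  euclidsLemma ℤ.∣ i ∣ ℤ.∣ j ∣ p-prime ∘ subst (p ℕD.∣_) (ℤ.abs-* i j)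

prime∣²⇒∣ : ∀ {p} → Prime p → ∀ r → + p Signed.∣ r ℤ.* r → + p Signed.∣ r
prime∣²⇒∣ p-prime r = ∣ᵤ⇒∣ ∘ [ id , id ]′ ∘ prime∣*⇒∣⊎∣ p-prime r r ∘ ∣⇒∣ᵤ

record SolvesModulo {n m} (p : ℕ) (E : Ext n m) (P : Poly (Fin n ⊎ Fin m))
                    (ρ : Fin n ⊎ Fin m → ℤ) : Set where
  field
    axiomHolds   : + p Signed.∣ ⟦ P ⟧ ρ
    booleanHolds : ∀ i → + p Signed.∣ ⟦ var (inj₁ i) ⊗ var (inj₁ i) ⊖ var (inj₁ i) ⟧ ρ
    extAxHolds   : ∀ j → + p Signed.∣ ⟦ extAx E j ⟧ ρ

Derivable-sound : ∀ {n m p} {E : Ext n m} {P ρ} → Prime p → SolvesModulo p E P ρ →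
                  ∀ {r} → Derivable E P r → + p Signed.∣ ⟦ r ⟧ ρ
Derivable-sound {p = p} {E} {P} {ρ} p-prime sol = go
  where
  open SolvesModulo sol
  go : ∀ {r} → Derivable E P r → + p Signed.∣ ⟦ r ⟧ ρ
  go axiom               = axiomHolds
  go (boolean i)         = booleanHolds i
  go (extax j)           = extAxHolds j
  go (lincomb a c d₁ d₂) = Signed.∣m∣n⇒∣m+n (Signed.∣n⇒∣m*n a (go d₁)) (Signed.∣n⇒∣m*n c (go d₂))
  go (mulvar v d)        = Signed.∣n⇒∣m*n (ρ v) (go d)
  go (sqrt r d s≈r²)     = prime∣²⇒∣ p-prime (⟦ r ⟧ ρ) (subst (_ Signed.∣_) (s≈r² ρ) (go d))
  go (conv d p≈q)        = subst (_ Signed.∣_) (p≈q ρ) (go d)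

∣0ℤ : ∀ {k x} → x ≡ ℤ.0ℤ → k Signed.∣ x
∣0ℤ refl = Signed.divides ℤ.0ℤ refl

bitEnv-solvesModulo : ∀ {m} M n p (E : Ext n m) (b : Fin n → Bool) →
                      p ℕD.∣ M + binVal n b →
                      SolvesModulo p E (ebvp M n) (extEnv E (bitℤ ∘ b))
bitEnv-solvesModulo M n p E b p∣M+t = record
  { axiomHolds   = subst (_ Signed.∣_) (sym (⟦ebvp⟧ M n E b)) (∣ᵤ⇒∣ p∣M+t)
  ; booleanHolds = λ i → ∣0ℤ (bitℤ-idempotent (b i))
  ; extAxHolds   = λ j → ∣0ℤ (⟦extAx⟧≡0 E (bitℤ ∘ b) j)
  }

y²-y≡y[y-1] : ∀ y → y ℤ.* y ℤ.+ ℤ.-1ℤ ℤ.* y ≡ y ℤ.* (y - ℤ.1ℤ)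
y²-y≡y[y-1] = solve-∀

corollary1 : (M n p t : ℕ) → 0 < M → Prime p → p < 2 ^ n →
    t < 2 ^ n → p ℕD.∣ (t + M) →
    (b : Fin n → Bool) → t ≡ binVal n b →
    (m : ℕ) (E : Ext n m) (i : Fin m) (C′ : ℤ) →
    Derivable E (ebvp M n)
      (con C′ ⊗ (var (inj₂ i) ⊗ var (inj₂ i) ⊖ var (inj₂ i))) →
    ((+ p) ℤD.∣ C′)
      ⊎ ((+ p) ℤD.∣ (val E (λ k → bitℤ (b k)) i - + 1))
      ⊎ ((+ p) ℤD.∣ val E (λ k → bitℤ (b k)) i)
corollary1 M n p t _ p-prime _ _ p∣t+M b refl m E i C′ derivation =
  [ inj₁ , inj₂ ∘ swap ∘ prime∣*⇒∣⊎∣ p-prime y (y - ℤ.1ℤ) ]′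
    (prime∣*⇒∣⊎∣ p-prime C′ (y ℤ.* (y - ℤ.1ℤ)) (∣⇒∣ᵤ p∣C′y[y-1]))
  where
  y : ℤ
  y = val E (bitℤ ∘ b) i

  p∣M+t : p ℕD.∣ M + binVal n b
  p∣M+t = subst (p ℕD.∣_) (ℕ.+-comm (binVal n b) M) p∣t+M

  p∣C′y[y-1] : + p Signed.∣ C′ ℤ.* (y ℤ.* (y - ℤ.1ℤ))
  p∣C′y[y-1] = subst (_ Signed.∣_) (cong (C′ ℤ.*_) (y²-y≡y[y-1] y))
    (Derivable-sound p-prime (bitEnv-solvesModulo M n p E b p∣M+t) derivation)
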